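{- Let $n\ge 1$ and let $S,T\subseteq[n]$ with $S\le T$ in the type $C_n$ Gale order. Then \[P(\Delta[S,T])=\Big\{x\in\mathbb{R}^n \;:\; |S_{\ge i}|\le x_i+x_{i+1}+\cdots+x_n\le |T_{\ge i}| \text{ and } 0\le x_i\le 1 \text{ for all } i\in[n]\Big\}.\]
   Context: $[n]=\{1,\dots,n\}$. Type $C_n$ Gale order on subsets of $[n]$: for $A=\{a_1<\dots<a_j\}$ and $B=\{b_1<\dots<b_k\}$, $A\le B$ iff $j\le k$ and $a_{j-i+1}\le b_{k-i+1}$ for all $i\in[j]$. For $S\subseteq[n]$, $S_{\ge i}=\{s\in S: s\ge i\}$. For $S\le T$, the lattice path delta matroid $\Delta[S,T]$ is the delta matroid on $[n]$ whose feasible sets are all $R\subseteq[n]$ with $S\le R\le T$. Its feasible polytope is $P(\Delta[S,T])=\operatorname{conv}\{e_R: R \text{ feasible}\}\subseteq\mathbb{R}^n$, where $e_R=\sum_{i\in R}e_i$ and $e_1,\dots,e_n$ is the standard basis.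
   Formalization: The points x range over ℚ^n instead of ℝ^n, and the convex combinations of the vectors $e_R$ defining $P(\Delta[S,T])$ have rational coefficients. -}

module Defs where

open import Data.Bool using (Bool; true; false; if_then_else_)
open import Data.Nat as ℕ using (ℕ; zero; suc; _≤ᵇ_)
open import Data.Fin using (Fin; toℕ)
import Data.Fin
open import Data.Fin.Subset using (Subset)
open import Data.Fin.Subset.Properties using (_∈?_)
open import Data.List using (List; []; _∷_; filter; map; reverse; length; allFin)
open import Data.Vec using (lookup)
open import Data.Integer using (+_)
open import Data.Rational using (ℚ; 0ℚ; 1ℚ; _+_; _*_; _≤_; _/_)
open import Data.Product using (Σ; ∃; _×_)
open import Relation.Binary.PropositionalEquality using (_≡_)
open import Relation.Nullary.Decidable using (Dec)

-- Elements of [n] are encoded by Fin n: index i : Fin n stands for toℕ i + 1.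
-- Elements of a subset, as numbers in [n], in increasing order.
elemsAsc : ∀ {n} → Subset n → List ℕ
elemsAsc {n} A = map (λ i → suc (toℕ i)) (filter (λ i → i ∈? A) (allFin n))

elemsDesc : ∀ {n} → Subset n → List ℕ
elemsDesc A = reverse (elemsAsc A)

data GaleList : List ℕ → List ℕ → Set where
  nil  : ∀ {ys} → GaleList [] ys
  cons : ∀ {x y xs ys} → x ℕ.≤ y → GaleList xs ys → GaleList (x ∷ xs) (y ∷ ys)

_≤G_ : ∀ {n} → Subset n → Subset n → Set
A ≤G B = GaleList (elemsDesc A) (elemsDesc B)

Feasible : ∀ {n} → Subset n → Subset n → Subset n → Set
Feasible S T R = (S ≤G R) × (R ≤G T)

Σℚ : ∀ {m} → (Fin m → ℚ) → ℚ
Σℚ {zero}  f = 0ℚ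
Σℚ {suc m} f = f Data.Fin.zero + Σℚ (λ k → f (Data.Fin.suc k))


indicator : ∀ {n} → Subset n → Fin n → ℚ
indicator R i = if lookup R i then 1ℚ else 0ℚ

InFeasiblePolytope : ∀ {n} → Subset n → Subset n → (Fin n → ℚ) → Set
InFeasiblePolytope {n} S T x =
  Σ ℕ λ m → Σ (Fin m → ℚ) λ c → Σ (Fin m → Subset n) λ R →
    ((k : Fin m) → Feasible S T (R k)) ×
    ((k : Fin m) → 0ℚ ≤ c k) ×
    (Σℚ c ≡ 1ℚ) ×
    ((i : Fin n) → x i ≡ Σℚ (λ k → c k * indicator (R k) i))

cardGe : ∀ {n} → Subset n → Fin n → ℕ
cardGe A i = length (filter (λ s → suc (toℕ i) ℕ.≤? s) (elemsAsc A))

tailSum : ∀ {n} → (Fin n → ℚ) → Fin n → ℚ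
tailSum x i = Σℚ (λ j → if toℕ i ≤ᵇ toℕ j then x j else 0ℚ)

ℕtoℚ : ℕ → ℚ
ℕtoℚ k = + k / 1

InHPolytope : ∀ {n} → Subset n → Subset n → (Fin n → ℚ) → Set
InHPolytope {n} S T x = (i : Fin n) →
  (ℕtoℚ (cardGe S i) ≤ tailSum x i) × (tailSum x i ≤ ℕtoℚ (cardGe T i)) ×
  (0ℚ ≤ x i) × (x i ≤ 1ℚ)

-- R is feasible for Δ[S,T] iff |S_{≥i}| ≤ |R_{≥i}| ≤ |T_{≥i}| for every i, and each bound is
-- linear in e_R; so every convex combination of feasible e_R satisfies the inequalities.
-- Conversely, clear denominators: D·x = b ∈ ℕⁿ with 0 ≤ b_j ≤ D, and the suffix sums
-- B_i = b_i + … + b_n satisfy D|S_{≥i}| ≤ B_i ≤ D|T_{≥i}|. For k = 0, …, D-1 let R_k be the set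
-- of j at which ⌊(B_j + k)/D⌋ exceeds ⌊(B_{j+1} + k)/D⌋ (by at most one, as b_j ≤ D). Then
-- |(R_k)_{≥i}| = ⌊(B_i + k)/D⌋ lies between |S_{≥i}| and |T_{≥i}|, and by Hermite's identity
-- Σ_{k<D} ⌊(a + k)/D⌋ = a each j lies in exactly b_j of the R_k, so x = (1/D) Σ_k e_{R_k}.
module Submission where

open import Defs
open import Data.Nat using (ℕ; _≤_)
open import Data.Fin using (Fin)
open import Data.Fin.Subset using (Subset)
open import Data.Rational using (ℚ)
open import Function.Bundles using (_⇔_; mk⇔)

open import Algebra.Bundles using (Ring)
import Algebra.Properties.Semiring.Sum as SemiringSum
open import Data.Bool using (Bool; true; false; if_then_else_; _∧_)
open import Data.Bool.Properties using (if-float; if-cong-else)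
open import Data.Empty using (⊥-elim)
open import Data.Fin using (zero; suc; toℕ; fromℕ; fromℕ<; inject₁)
open import Data.Fin.Properties using (toℕ<n; toℕ-fromℕ<; toℕ-fromℕ; toℕ-inject₁)
open import Data.Fin.Subset.Properties using (_∈?_)
import Data.Integer as ℤ
import Data.Integer.Properties as ℤP
open import Data.List using (List; []; _∷_; filter; map; reverse; length; tabulate; allFin)
open import Data.List.Properties using (filter-accept; filter-none; unfold-reverse)
open import Data.List.Relation.Binary.Permutation.Propositional using (↭-sym)
open import Data.List.Relation.Binary.Permutation.Propositional.Properties
  using (↭-length; ↭-reverse; filter-↭; All-resp-↭)
open import Data.List.Relation.Unary.All as All using (All; []; _∷_)
import Data.List.Relation.Unary.All.Properties as AllP
open import Data.List.Relation.Unary.AllPairs using (AllPairs; []; _∷_)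
import Data.List.Relation.Unary.AllPairs.Properties as AllPairsP
open import Data.Nat using (zero; suc; _+_; _*_; _<_; _>_; _≤ᵇ_; _<ᵇ_; _/_; z≤n; s≤s; s≤s⁻¹; NonZero)
open import Data.Nat.Divisibility using (∣-refl)
open import Data.Nat.DivMod using (m<n⇒m/n≡0; /-monoˡ-≤; m*n/n≡m; m<n*o⇒m/o<n; +-distrib-/-∣ˡ; n/n≡1)
open import Data.Nat.Properties
open import Data.Nat.Coprimality as Coprime using ()
open import Data.Product using (_×_; _,_; proj₁; proj₂; ∃₂)
open import Data.Rational as Q using (mkℚ; 0ℚ; 1ℚ; *≤*)
import Data.Rational.Properties as ℚP
open import Data.Vec using ([]; _∷_; lookup)
open import Function using (_∘_; flip; id)
open import Level using (0ℓ)
open import Relation.Binary.PropositionalEquality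
open import Relation.Nullary using (yes; no; does)
open import Relation.Nullary.Decidable using (_×-dec_)
open import Relation.Nullary.Reflects using (ofʸ; ofⁿ)
open import Relation.Unary using (Pred; Decidable)

module ℕΣ = SemiringSum +-*-semiring
module ℚΣ = SemiringSum (Ring.semiring ℚP.+-*-ring)
open ℕΣ using (sum-init-last; sum-replicate-zero; ∑-distrib-+)
  renaming (sum to ∑ℕ; sum-cong-≗ to ∑ℕ-cong)
open ℚΣ using (*-distribˡ-sum; *-distribʳ-sum)
  renaming (sum to ∑ℚ; sum-cong-≗ to ∑ℚ-cong; ∑-comm to ∑ℚ-comm)

-- The Gale order by counting

count≥ : ℕ → List ℕ → ℕ
count≥ t xs = length (filter (t ≤?_) xs)

Descending : List ℕ → Set
Descending = AllPairs _>_

count≥-accept : ∀ {t x} xs → t ≤ x → count≥ t (x ∷ xs) ≡ suc (count≥ t xs)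
count≥-accept {t} _ t≤x = cong length (filter-accept (t ≤?_) t≤x)

count≥-none : ∀ {t xs} → All (_< t) xs → count≥ t xs ≡ 0
count≥-none {t} xs<t = cong length (filter-none (t ≤?_) (All.map <⇒≱ xs<t))

head<⇒all< : ∀ {t x xs} → Descending (x ∷ xs) → x < t → All (_< t) (x ∷ xs)
head<⇒all< (xs<x ∷ _) x<t = x<t ∷ All.map (λ y<x → <-trans y<x x<t) xs<x

count≥-head-positive : ∀ x xs ys → count≥ x (x ∷ xs) ≤ count≥ x ys → count≥ x ys ≢ 0
count≥-head-positive x xs _ le ys≡0 = n≮0 (subst₂ _≤_ (count≥-accept xs (≤-refl {x})) ys≡0 le)

gale⇒count≥ : ∀ {xs ys} → Descending xs → GaleList xs ys → ∀ t → count≥ t xs ≤ count≥ t ys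
gale⇒count≥ _ nil _ = z≤n
gale⇒count≥ {x ∷ xs} {y ∷ ys} dxs@(_ ∷ dxs′) (cons x≤y g) t with t ≤? x
... | yes t≤x = subst₂ _≤_ (sym (count≥-accept xs t≤x)) (sym (count≥-accept ys (≤-trans t≤x x≤y)))
                  (s≤s (gale⇒count≥ dxs′ g t))
... | no t≰x = ≤-trans (≤-reflexive (count≥-none (head<⇒all< dxs (≰⇒> t≰x)))) z≤n

count≥⇒gale : ∀ {xs ys} → Descending xs → Descending ys → All (1 ≤_) xs →
              (∀ t → 1 ≤ t → count≥ t xs ≤ count≥ t ys) → GaleList xs ys
count≥⇒gale {[]} _ _ _ _ = nil
count≥⇒gale {x ∷ xs} {[]} _ _ (1≤x ∷ _) H = ⊥-elim (count≥-head-positive x xs [] (H x 1≤x) refl)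
count≥⇒gale {x ∷ xs} {y ∷ ys} dxs@(_ ∷ dxs′) dys@(_ ∷ dys′) (1≤x ∷ xs≥1) H =
  cons x≤y (count≥⇒gale dxs′ dys′ xs≥1 H′)
  where
  x≤y : x ≤ y
  x≤y with x ≤? y
  ... | yes x≤y = x≤y
  ... | no x≰y = ⊥-elim (count≥-head-positive x xs (y ∷ ys) (H x 1≤x)
                   (count≥-none (head<⇒all< dys (≰⇒> x≰y))))

  H′ : ∀ t → 1 ≤ t → count≥ t xs ≤ count≥ t ys
  H′ t 1≤t with t ≤? x
  ... | yes t≤x = s≤s⁻¹ (subst₂ _≤_ (count≥-accept xs t≤x) (count≥-accept ys (≤-trans t≤x x≤y))
                          (H t 1≤t))
  ... | no t≰x = ≤-trans (≤-reflexive (count≥-none (All.tail (head<⇒all< dxs (≰⇒> t≰x))))) z≤n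

AllPairs-reverse : ∀ {A : Set} {R : A → A → Set} {xs} → AllPairs R xs → AllPairs (flip R) (reverse xs)
AllPairs-reverse [] = []
AllPairs-reverse {R = R} {x ∷ xs} (Rx ∷ Rxs) =
  subst (AllPairs (flip R)) (sym (unfold-reverse x xs))
    (AllPairsP.++⁺ (AllPairs-reverse Rxs) ([] ∷ [])
      (All.map (_∷ []) (All-resp-↭ (↭-sym (↭-reverse xs)) Rx)))

elemsDesc-descending : ∀ {n} (A : Subset n) → Descending (elemsDesc A)
elemsDesc-descending A = AllPairs-reverse (AllPairsP.map⁺ (AllPairsP.filter⁺ (_∈? A)
  (AllPairsP.tabulate⁺-< {R = λ i j → suc (toℕ i) < suc (toℕ j)} s≤s)))

elemsDesc-bounds : ∀ {n} (A : Subset n) → All (λ s → 1 ≤ s × s ≤ n) (elemsDesc A)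
elemsDesc-bounds A = All-resp-↭ (↭-sym (↭-reverse _))
  (AllP.map⁺ (AllP.filter⁺ (_∈? A) (AllP.tabulate⁺ (λ i → s≤s z≤n , toℕ<n i))))

cardGe≡count≥ : ∀ {n} (A : Subset n) i → cardGe A i ≡ count≥ (suc (toℕ i)) (elemsDesc A)
cardGe≡count≥ A i = sym (↭-length (filter-↭ (suc (toℕ i) ≤?_) (↭-reverse (elemsAsc A))))

≤G⇒cardGe≤ : ∀ {n} {A B : Subset n} → A ≤G B → ∀ i → cardGe A i ≤ cardGe B i
≤G⇒cardGe≤ {A = A} {B} A≤B i = subst₂ _≤_ (sym (cardGe≡count≥ A i)) (sym (cardGe≡count≥ B i))
  (gale⇒count≥ (elemsDesc-descending A) A≤B (suc (toℕ i)))

cardGe≤⇒≤G : ∀ {n} {A B : Subset n} → (∀ i → cardGe A i ≤ cardGe B i) → A ≤G B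
cardGe≤⇒≤G {n} {A} {B} H =
  count≥⇒gale (elemsDesc-descending A) (elemsDesc-descending B) (All.map proj₁ (elemsDesc-bounds A)) H′
  where
  H′ : ∀ t → 1 ≤ t → count≥ t (elemsDesc A) ≤ count≥ t (elemsDesc B)
  H′ (suc t) _ with t <? n
  ... | yes t<n rewrite sym (toℕ-fromℕ< t<n) =
    subst₂ _≤_ (cardGe≡count≥ A _) (cardGe≡count≥ B _) (H (fromℕ< t<n))
  ... | no t≮n = ≤-trans (≤-reflexive (count≥-none
          (All.map (λ (_ , s≤n) → s≤s (≤-trans s≤n (≮⇒≥ t≮n))) (elemsDesc-bounds A)))) z≤n

bit : Bool → ℕ
bit b = if b then 1 else 0

tailSumℕ : ∀ {n} → (Fin n → ℕ) → Fin n → ℕ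
tailSumℕ f i = ∑ℕ (λ j → if toℕ i ≤ᵇ toℕ j then f j else 0)

suc≤ᵇsuc : ∀ m n → (suc m ≤ᵇ suc n) ≡ (m ≤ᵇ n)
suc≤ᵇsuc zero    _ = refl
suc≤ᵇsuc (suc m) _ = refl

tailSumℕ-suc : ∀ {n} (f : Fin (suc n) → ℕ) i → tailSumℕ f (suc i) ≡ tailSumℕ (f ∘ suc) i
tailSumℕ-suc f i =
  ∑ℕ-cong (λ j → cong (λ c → if c then f (suc j) else 0) (suc≤ᵇsuc (toℕ i) (toℕ j)))

module _ {A : Set} {P : Pred A 0ℓ} (P? : Decidable P) where

  length-filter-map : {B : Set} (g : B → A) (xs : List B) →
    length (filter P? (map g xs)) ≡ length (filter (P? ∘ g) xs)
  length-filter-map g [] = refl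
  length-filter-map g (x ∷ xs) with does (P? (g x))
  ... | true  = cong suc (length-filter-map g xs)
  ... | false = length-filter-map g xs

  length-filter-filter : {Q : Pred A 0ℓ} (Q? : Decidable Q) (xs : List A) →
    length (filter P? (filter Q? xs)) ≡ length (filter (λ x → Q? x ×-dec P? x) xs)
  length-filter-filter Q? [] = refl
  length-filter-filter Q? (x ∷ xs) with does (Q? x)
  ... | false = length-filter-filter Q? xs
  ... | true with does (P? x)
  ...   | true  = cong suc (length-filter-filter Q? xs)
  ...   | false = length-filter-filter Q? xs

  length-filter-tabulate : ∀ {n} (f : Fin n → A) →
    length (filter P? (tabulate f)) ≡ ∑ℕ (λ j → bit (does (P? (f j))))
  length-filter-tabulate {zero} f = refl
  length-filter-tabulate {suc n} f with does (P? (f zero))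
  ... | true  = cong suc (length-filter-tabulate (f ∘ suc))
  ... | false = length-filter-tabulate (f ∘ suc)

does-∈? : ∀ {n} (A : Subset n) j → does (j ∈? A) ≡ lookup A j
does-∈? (true  ∷ _) zero    = refl
does-∈? (false ∷ _) zero    = refl
does-∈? (_     ∷ A) (suc j) = does-∈? A j

bit-∧ : ∀ a c → bit (a ∧ c) ≡ (if c then bit a else 0)
bit-∧ true  true  = refl
bit-∧ true  false = refl
bit-∧ false true  = refl
bit-∧ false false = refl

cardGe≡tailSumℕ : ∀ {n} (A : Subset n) i → cardGe A i ≡ tailSumℕ (bit ∘ lookup A) i
cardGe≡tailSumℕ {n} A i = begin
  cardGe A i
    ≡⟨ length-filter-map (suc (toℕ i) ≤?_) (suc ∘ toℕ) (filter (_∈? A) (allFin n)) ⟩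
  length (filter (λ j → suc (toℕ i) ≤? suc (toℕ j)) (filter (_∈? A) (allFin n)))
    ≡⟨ length-filter-filter (λ j → suc (toℕ i) ≤? suc (toℕ j)) (_∈? A) (allFin n) ⟩
  length (filter (λ j → j ∈? A ×-dec suc (toℕ i) ≤? suc (toℕ j)) (allFin n))
    ≡⟨ length-filter-tabulate (λ j → j ∈? A ×-dec suc (toℕ i) ≤? suc (toℕ j)) id ⟩
  ∑ℕ (λ j → bit (does (j ∈? A) ∧ (suc (toℕ i) ≤ᵇ suc (toℕ j))))
    ≡⟨ ∑ℕ-cong (λ j → trans (cong₂ (λ a c → bit (a ∧ c)) (does-∈? A j) (suc≤ᵇsuc (toℕ i) (toℕ j)))
                            (bit-∧ (lookup A j) _)) ⟩
  tailSumℕ (bit ∘ lookup A) i ∎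
  where open ≡-Reasoning

-- Floors of shifted quotients and the staircase sets

module _ (D : ℕ) .{{_ : NonZero D}} where

  jumps : ℕ → ℕ → Bool
  jumps e u = u / D <ᵇ (e + u) / D

  [D+u]/D≡1+u/D : ∀ u → (D + u) / D ≡ suc (u / D)
  [D+u]/D≡1+u/D u = trans (+-distrib-/-∣ˡ u ∣-refl) (cong (_+ u / D) (n/n≡1 D))

  floor-step : ∀ {e} u → e ≤ D → bit (jumps e u) + u / D ≡ (e + u) / D
  floor-step {e} u e≤D with jumps e u | <ᵇ-reflects-< (u / D) ((e + u) / D)
  ... | true  | ofʸ u/D<[e+u]/D = ≤-antisym u/D<[e+u]/D
          (≤-trans (/-monoˡ-≤ D (+-monoˡ-≤ u e≤D)) (≤-reflexive ([D+u]/D≡1+u/D u)))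
  ... | false | ofⁿ u/D≮[e+u]/D = ≤-antisym (/-monoˡ-≤ D (m≤n+m u e)) (≮⇒≥ u/D≮[e+u]/D)

  hermite : ∀ a → ∑ℕ {D} (λ k → (a + toℕ k) / D) ≡ a
  hermite zero = trans (∑ℕ-cong {D} (λ k → m<n⇒m/n≡0 (toℕ<n k))) (sum-replicate-zero D)
  hermite (suc a) = +-cancelˡ-≡ (a / D) _ _ (begin
    a / D + ∑ℕ {D} (λ k → (suc a + toℕ k) / D)
      ≡⟨ cong₂ _+_ (cong (_/ D) (sym (+-identityʳ a)))
                   (∑ℕ-cong {D} (λ k → cong (_/ D) (sym (+-suc a (toℕ k))))) ⟩
    ∑ℕ {suc D} (λ k → (a + toℕ k) / D)
      ≡⟨ sum-init-last (λ k → (a + toℕ k) / D) ⟩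
    ∑ℕ {D} (λ k → (a + toℕ (inject₁ k)) / D) + (a + toℕ (fromℕ D)) / D
      ≡⟨ cong₂ _+_ (∑ℕ-cong {D} (λ k → cong (λ m → (a + m) / D) (toℕ-inject₁ k)))
                   (cong (λ m → (a + m) / D) (toℕ-fromℕ D)) ⟩
    ∑ℕ {D} (λ k → (a + toℕ k) / D) + (a + D) / D
      ≡⟨ cong₂ _+_ (hermite a) (trans (cong (_/ D) (+-comm a D)) ([D+u]/D≡1+u/D a)) ⟩
    a + suc (a / D)
      ≡⟨ +-comm a (suc (a / D)) ⟩
    suc (a / D + a)
      ≡⟨ sym (+-suc (a / D) a) ⟩
    a / D + suc a ∎)
    where open ≡-Reasoning

  floor-between : ∀ {s t B k} → s * D ≤ B → B ≤ t * D → k < D → s ≤ (B + k) / D × (B + k) / D ≤ t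
  floor-between {s} {t} {B} {k} sD≤B B≤tD k<D =
      ≤-trans (≤-reflexive (sym (m*n/n≡m s D))) (/-monoˡ-≤ D (≤-trans sD≤B (m≤m+n B k)))
    , s≤s⁻¹ (m<n*o⇒m/o<n (<-≤-trans (+-mono-≤-< B≤tD k<D) (≤-reflexive (+-comm (t * D) D))))

  -- j ∈ staircase b k iff ⌊(B_{j+1} + k)/D⌋ < ⌊(B_j + k)/D⌋, where B_j = b_j + ⋯ + b_{n-1}.
  staircase : ∀ {n} → (Fin n → ℕ) → ℕ → Subset n
  staircase {zero}  _ _ = []
  staircase {suc n} b k = jumps (b zero) (∑ℕ (b ∘ suc) + k) ∷ staircase (b ∘ suc) k

  staircase-∑ : ∀ {n} (b : Fin n → ℕ) → (∀ j → b j ≤ D) → ∀ {k} → k < D →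
                ∑ℕ (bit ∘ lookup (staircase b k)) ≡ (∑ℕ b + k) / D
  staircase-∑ {zero}  _ _ k<D = sym (m<n⇒m/n≡0 k<D)
  staircase-∑ {suc n} b b≤D {k} k<D = begin
    bit (jumps (b zero) B) + ∑ℕ (bit ∘ lookup (staircase (b ∘ suc) k))
      ≡⟨ cong (bit (jumps (b zero) B) +_) (staircase-∑ (b ∘ suc) (b≤D ∘ suc) k<D) ⟩
    bit (jumps (b zero) B) + B / D
      ≡⟨ floor-step B (b≤D zero) ⟩
    (b zero + B) / D
      ≡⟨ cong (_/ D) (sym (+-assoc (b zero) _ k)) ⟩
    (∑ℕ b + k) / D ∎
    where
    open ≡-Reasoning
    B = ∑ℕ (b ∘ suc) + k

  staircase-tailSum : ∀ {n} (b : Fin n → ℕ) → (∀ j → b j ≤ D) → ∀ {k} → k < D → ∀ i →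
                      tailSumℕ (bit ∘ lookup (staircase b k)) i ≡ (tailSumℕ b i + k) / D
  staircase-tailSum b b≤D k<D zero = staircase-∑ b b≤D k<D
  staircase-tailSum b b≤D {k} k<D (suc i) = begin
    tailSumℕ (bit ∘ lookup (staircase b k)) (suc i)
      ≡⟨ tailSumℕ-suc (bit ∘ lookup (staircase b k)) i ⟩
    tailSumℕ (bit ∘ lookup (staircase (b ∘ suc) k)) i
      ≡⟨ staircase-tailSum (b ∘ suc) (b≤D ∘ suc) k<D i ⟩
    (tailSumℕ (b ∘ suc) i + k) / D
      ≡⟨ cong (λ m → (m + k) / D) (tailSumℕ-suc b i) ⟨
    (tailSumℕ b (suc i) + k) / D ∎
    where open ≡-Reasoning

  staircase-column : ∀ {n} (b : Fin n → ℕ) → (∀ j → b j ≤ D) → ∀ j →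
                     ∑ℕ {D} (λ k → bit (lookup (staircase b (toℕ k)) j)) ≡ b j
  staircase-column b b≤D (suc j) = staircase-column (b ∘ suc) (b≤D ∘ suc) j
  staircase-column b b≤D zero = +-cancelʳ-≡ B _ _ (begin
    ∑ℕ {D} (λ k → bit (jumps (b zero) (B + toℕ k))) + B
      ≡⟨ cong (∑ℕ {D} (λ k → bit (jumps (b zero) (B + toℕ k))) +_) (sym (hermite B)) ⟩
    ∑ℕ {D} (λ k → bit (jumps (b zero) (B + toℕ k))) + ∑ℕ {D} (λ k → (B + toℕ k) / D)
      ≡⟨ sym (∑-distrib-+ {D} (λ k → bit (jumps (b zero) (B + toℕ k))) (λ k → (B + toℕ k) / D)) ⟩
    ∑ℕ {D} (λ k → bit (jumps (b zero) (B + toℕ k)) + (B + toℕ k) / D)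
      ≡⟨ ∑ℕ-cong {D} (λ k → floor-step (B + toℕ k) (b≤D zero)) ⟩
    ∑ℕ {D} (λ k → (b zero + (B + toℕ k)) / D)
      ≡⟨ ∑ℕ-cong {D} (λ k → cong (_/ D) (sym (+-assoc (b zero) B (toℕ k)))) ⟩
    ∑ℕ {D} (λ k → (b zero + B + toℕ k) / D)
      ≡⟨ hermite (b zero + B) ⟩
    b zero + B ∎)
    where
    open ≡-Reasoning
    B = ∑ℕ (b ∘ suc)

  staircase-feasible : ∀ {n} {S T : Subset n} (b : Fin n → ℕ) → (∀ j → b j ≤ D) →
    (∀ i → cardGe S i * D ≤ tailSumℕ b i) → (∀ i → tailSumℕ b i ≤ cardGe T i * D) →
    ∀ {k} → k < D → Feasible S T (staircase b k)
  staircase-feasible {S = S} {T} b b≤D lower upper {k} k<D =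
    cardGe≤⇒≤G (proj₁ ∘ between) , cardGe≤⇒≤G (proj₂ ∘ between)
    where
    between : ∀ i → cardGe S i ≤ cardGe (staircase b k) i × cardGe (staircase b k) i ≤ cardGe T i
    between i rewrite cardGe≡tailSumℕ (staircase b k) i | staircase-tailSum b b≤D k<D i =
      floor-between (lower i) (upper i) k<D

-- ℕtoℚ k normalises to this form, on which ℚ arithmetic computes.
private
  canonical : ℕ → ℚ
  canonical k = mkℚ (ℤ.+ k) 0 (Coprime.sym (Coprime.1-coprimeTo k))

  ℕtoℚ≡canonical : ∀ k → ℕtoℚ k ≡ canonical k
  ℕtoℚ≡canonical k = ℚP.↥p/↧p≡p (canonical k)

ℕtoℚ-+ : ∀ a b → ℕtoℚ (a + b) ≡ ℕtoℚ a Q.+ ℕtoℚ b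
ℕtoℚ-+ a b rewrite ℕtoℚ≡canonical a | ℕtoℚ≡canonical b =
  ℚP./-cong (trans (ℤP.pos-+ a b)
                   (sym (cong₂ ℤ._+_ (ℤP.*-identityʳ (ℤ.+ a)) (ℤP.*-identityʳ (ℤ.+ b))))) refl

ℕtoℚ-* : ∀ a b → ℕtoℚ (a * b) ≡ ℕtoℚ a Q.* ℕtoℚ b
ℕtoℚ-* a b rewrite ℕtoℚ≡canonical a | ℕtoℚ≡canonical b = ℚP./-cong (ℤP.pos-* a b) refl

ℕtoℚ-mono-≤ : ∀ {a b} → a ≤ b → ℕtoℚ a Q.≤ ℕtoℚ b
ℕtoℚ-mono-≤ {a} {b} a≤b rewrite ℕtoℚ≡canonical a | ℕtoℚ≡canonical b =
  *≤* (subst₂ ℤ._≤_ (sym (ℤP.*-identityʳ (ℤ.+ a))) (sym (ℤP.*-identityʳ (ℤ.+ b))) (ℤ.+≤+ a≤b))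

ℕtoℚ-cancel-≤ : ∀ {a b} → ℕtoℚ a Q.≤ ℕtoℚ b → a ≤ b
ℕtoℚ-cancel-≤ {a} {b} a≤b with subst₂ Q._≤_ (ℕtoℚ≡canonical a) (ℕtoℚ≡canonical b) a≤b
... | *≤* a*1≤b*1 =
  ℤP.drop‿+≤+ (subst₂ ℤ._≤_ (ℤP.*-identityʳ (ℤ.+ a)) (ℤP.*-identityʳ (ℤ.+ b)) a*1≤b*1)

1/suc : ℕ → ℚ
1/suc d = Q.1/ canonical (suc d)

1/suc-nonNeg : ∀ d → 0ℚ Q.≤ 1/suc d
1/suc-nonNeg d = *≤* (ℤ.+≤+ z≤n)

1/suc-inverseˡ : ∀ d → 1/suc d Q.* ℕtoℚ (suc d) ≡ 1ℚ
1/suc-inverseˡ d rewrite ℕtoℚ≡canonical (suc d) = ℚP.*-inverseˡ (canonical (suc d))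

rescale : ∀ {q} a p c → q Q.* ℕtoℚ a ≡ ℕtoℚ p → q Q.* ℕtoℚ (a * c) ≡ ℕtoℚ (p * c)
rescale {q} a p c qa≡p = begin
  q Q.* ℕtoℚ (a * c)          ≡⟨ cong (q Q.*_) (ℕtoℚ-* a c) ⟩
  q Q.* (ℕtoℚ a Q.* ℕtoℚ c)   ≡⟨ sym (ℚP.*-assoc q _ _) ⟩
  (q Q.* ℕtoℚ a) Q.* ℕtoℚ c   ≡⟨ cong (Q._* ℕtoℚ c) qa≡p ⟩
  ℕtoℚ p Q.* ℕtoℚ c           ≡⟨ sym (ℕtoℚ-* p c) ⟩
  ℕtoℚ (p * c)                ∎
  where open ≡-Reasoning

clear-denominator : ∀ q → 0ℚ Q.≤ q → ∃₂ λ d p → q Q.* ℕtoℚ (suc d) ≡ ℕtoℚ p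
clear-denominator q@(mkℚ (ℤ.+ p) d _) _ = d , p , (begin
  q Q.* ℕtoℚ (suc d)                      ≡⟨ cong (Q._* ℕtoℚ (suc d)) q≡p/suc ⟩
  (ℕtoℚ p Q.* 1/suc d) Q.* ℕtoℚ (suc d)   ≡⟨ ℚP.*-assoc (ℕtoℚ p) _ _ ⟩
  ℕtoℚ p Q.* (1/suc d Q.* ℕtoℚ (suc d))   ≡⟨ cong (ℕtoℚ p Q.*_) (1/suc-inverseˡ d) ⟩
  ℕtoℚ p Q.* 1ℚ                           ≡⟨ ℚP.*-identityʳ (ℕtoℚ p) ⟩
  ℕtoℚ p                                  ∎)
  where
  open ≡-Reasoning
  q≡p/suc : q ≡ ℕtoℚ p Q.* 1/suc d
  q≡p/suc = begin
    q                          ≡⟨ ℚP.↥p/↧p≡p q ⟨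
    ℤ.+ p Q./ suc d            ≡⟨ ℚP./-cong (sym (ℤP.*-identityʳ (ℤ.+ p))) (sym (+-identityʳ (suc d))) ⟩
    canonical p Q.* 1/suc d    ≡⟨ cong (Q._* 1/suc d) (ℕtoℚ≡canonical p) ⟨
    ℕtoℚ p Q.* 1/suc d         ∎
clear-denominator (mkℚ ℤ.-[1+ _ ] _ _) (*≤* ())

common-denominator : ∀ {n} (x : Fin n → ℚ) → (∀ j → 0ℚ Q.≤ x j) →
                     ∃₂ λ d (b : Fin n → ℕ) → ∀ j → x j Q.* ℕtoℚ (suc d) ≡ ℕtoℚ (b j)
common-denominator {zero} _ _ = 0 , (λ ()) , λ ()
common-denominator {suc n} x x≥0
  with clear-denominator (x zero) (x≥0 zero) | common-denominator (x ∘ suc) (x≥0 ∘ suc)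
... | d₀ , p , x₀-scaled | d , b , xs-scaled = d + d₀ * suc d , b′ , scaled
  where
  b′ : Fin (suc n) → ℕ
  b′ zero    = p * suc d
  b′ (suc j) = b j * suc d₀

  scaled : ∀ j → x j Q.* ℕtoℚ (suc d₀ * suc d) ≡ ℕtoℚ (b′ j)
  scaled zero    = rescale {x zero} (suc d₀) p (suc d) x₀-scaled
  scaled (suc j) = subst (λ m → x (suc j) Q.* ℕtoℚ m ≡ ℕtoℚ (b j * suc d₀))
                     (*-comm (suc d) (suc d₀)) (rescale {x (suc j)} (suc d) (b j) (suc d₀) (xs-scaled j))

Σℚ≡∑ℚ : ∀ {m} (f : Fin m → ℚ) → Σℚ f ≡ ∑ℚ f
Σℚ≡∑ℚ {zero}  _ = refl
Σℚ≡∑ℚ {suc m} f = cong (f zero Q.+_) (Σℚ≡∑ℚ (f ∘ suc))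

∑ℚ-mono-≤ : ∀ {m} {f g : Fin m → ℚ} → (∀ k → f k Q.≤ g k) → ∑ℚ f Q.≤ ∑ℚ g
∑ℚ-mono-≤ {zero}  _   = ℚP.≤-refl
∑ℚ-mono-≤ {suc m} f≤g = ℚP.+-mono-≤ (f≤g zero) (∑ℚ-mono-≤ (f≤g ∘ suc))

∑ℚ-const : ∀ m q → ∑ℚ {m} (λ _ → q) ≡ ℕtoℚ m Q.* q
∑ℚ-const zero    q = sym (ℚP.*-zeroˡ q)
∑ℚ-const (suc m) q = begin
  q Q.+ ∑ℚ {m} (λ _ → q)          ≡⟨ cong₂ Q._+_ (sym (ℚP.*-identityˡ q)) (∑ℚ-const m q) ⟩
  1ℚ Q.* q Q.+ ℕtoℚ m Q.* q       ≡⟨ ℚP.*-distribʳ-+ q 1ℚ (ℕtoℚ m) ⟨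
  (1ℚ Q.+ ℕtoℚ m) Q.* q           ≡⟨ cong (Q._* q) (ℕtoℚ-+ 1 m) ⟨
  ℕtoℚ (suc m) Q.* q              ∎
  where open ≡-Reasoning

ℕtoℚ-∑ : ∀ {m} (f : Fin m → ℕ) → ℕtoℚ (∑ℕ f) ≡ ∑ℚ (ℕtoℚ ∘ f)
ℕtoℚ-∑ {zero}  _ = refl
ℕtoℚ-∑ {suc m} f = trans (ℕtoℚ-+ (f zero) _) (cong (ℕtoℚ (f zero) Q.+_) (ℕtoℚ-∑ (f ∘ suc)))

module _ {m} {c : Fin m → ℚ} (c≥0 : ∀ k → 0ℚ Q.≤ c k) (∑c≡1 : ∑ℚ c ≡ 1ℚ) where

  weighted-const : ∀ a → ∑ℚ (λ k → c k Q.* a) ≡ a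
  weighted-const a = trans (sym (*-distribʳ-sum a c)) (trans (cong (Q._* a) ∑c≡1) (ℚP.*-identityˡ a))

  weighted-mono : ∀ {y z : Fin m → ℚ} → (∀ k → y k Q.≤ z k) →
                  ∑ℚ (λ k → c k Q.* y k) Q.≤ ∑ℚ (λ k → c k Q.* z k)
  weighted-mono y≤z = ∑ℚ-mono-≤ (λ k → ℚP.*-monoˡ-≤-nonNeg (c k) {{Q.nonNegative (c≥0 k)}} (y≤z k))

  convex-lower : ∀ {a} {y : Fin m → ℚ} → (∀ k → a Q.≤ y k) → a Q.≤ ∑ℚ (λ k → c k Q.* y k)
  convex-lower {a} a≤y = subst (Q._≤ _) (weighted-const a) (weighted-mono a≤y)

  convex-upper : ∀ {a} {y : Fin m → ℚ} → (∀ k → y k Q.≤ a) → ∑ℚ (λ k → c k Q.* y k) Q.≤ a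
  convex-upper {a} y≤a = subst (_ Q.≤_) (weighted-const a) (weighted-mono y≤a)

tailSum≡∑ℚ : ∀ {n} (x : Fin n → ℚ) i →
             tailSum x i ≡ ∑ℚ (λ j → if toℕ i ≤ᵇ toℕ j then x j else 0ℚ)
tailSum≡∑ℚ x i = Σℚ≡∑ℚ (λ j → if toℕ i ≤ᵇ toℕ j then x j else 0ℚ)

tailSum-ℕtoℚ : ∀ {n} {x : Fin n → ℚ} {f : Fin n → ℕ} → (∀ j → x j ≡ ℕtoℚ (f j)) →
               ∀ i → tailSum x i ≡ ℕtoℚ (tailSumℕ f i)
tailSum-ℕtoℚ {x = x} {f} x≡f i = begin
  tailSum x i
    ≡⟨ tailSum≡∑ℚ x i ⟩
  ∑ℚ (λ j → if toℕ i ≤ᵇ toℕ j then x j else 0ℚ)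
    ≡⟨ ∑ℚ-cong (λ j → pointwise (toℕ i ≤ᵇ toℕ j) j) ⟩
  ∑ℚ (λ j → ℕtoℚ (if toℕ i ≤ᵇ toℕ j then f j else 0))
    ≡⟨ ℕtoℚ-∑ (λ j → if toℕ i ≤ᵇ toℕ j then f j else 0) ⟨
  ℕtoℚ (tailSumℕ f i) ∎
  where
  open ≡-Reasoning
  pointwise : ∀ c j → (if c then x j else 0ℚ) ≡ ℕtoℚ (if c then f j else 0)
  pointwise c j = trans (cong (λ q → if c then q else 0ℚ) (x≡f j)) (sym (if-float ℕtoℚ c))

indicator≡bit : ∀ {n} (R : Subset n) j → indicator R j ≡ ℕtoℚ (bit (lookup R j))
indicator≡bit R j with lookup R j
... | true  = refl
... | false = refl

indicator-bounds : ∀ {n} (R : Subset n) j → 0ℚ Q.≤ indicator R j × indicator R j Q.≤ 1ℚ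
indicator-bounds R j with lookup R j
... | true  = *≤* (ℤ.+≤+ z≤n) , ℚP.≤-refl
... | false = ℚP.≤-refl , *≤* (ℤ.+≤+ z≤n)

tailSum-indicator : ∀ {n} (R : Subset n) i → tailSum (indicator R) i ≡ ℕtoℚ (cardGe R i)
tailSum-indicator R i = trans (tailSum-ℕtoℚ (indicator≡bit R) i) (cong ℕtoℚ (sym (cardGe≡tailSumℕ R i)))

tailSum-*ʳ : ∀ {n} (x : Fin n → ℚ) q i → tailSum x i Q.* q ≡ tailSum (λ j → x j Q.* q) i
tailSum-*ʳ x q i = begin
  tailSum x i Q.* q
    ≡⟨ cong (Q._* q) (tailSum≡∑ℚ x i) ⟩
  ∑ℚ (λ j → if toℕ i ≤ᵇ toℕ j then x j else 0ℚ) Q.* q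
    ≡⟨ *-distribʳ-sum q (λ j → if toℕ i ≤ᵇ toℕ j then x j else 0ℚ) ⟩
  ∑ℚ (λ j → (if toℕ i ≤ᵇ toℕ j then x j else 0ℚ) Q.* q)
    ≡⟨ ∑ℚ-cong (λ j → pointwise (toℕ i ≤ᵇ toℕ j) j) ⟩
  ∑ℚ (λ j → if toℕ i ≤ᵇ toℕ j then x j Q.* q else 0ℚ)
    ≡⟨ tailSum≡∑ℚ (λ j → x j Q.* q) i ⟨
  tailSum (λ j → x j Q.* q) i ∎
  where
  open ≡-Reasoning
  pointwise : ∀ c j → (if c then x j else 0ℚ) Q.* q ≡ (if c then x j Q.* q else 0ℚ)
  pointwise c j = trans (if-float (Q._* q) c) (if-cong-else c (ℚP.*-zeroˡ q))

tailSum-combination : ∀ {n m} {x : Fin n → ℚ} (c : Fin m → ℚ) (v : Fin m → Fin n → ℚ) →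
  (∀ j → x j ≡ ∑ℚ (λ k → c k Q.* v k j)) →
  ∀ i → tailSum x i ≡ ∑ℚ (λ k → c k Q.* tailSum (v k) i)
tailSum-combination {m = m} {x} c v x≡ i = begin
  tailSum x i
    ≡⟨ tailSum≡∑ℚ x i ⟩
  ∑ℚ (λ j → if i≤ j then x j else 0ℚ)
    ≡⟨ ∑ℚ-cong (λ j → pointwise (i≤ j) j) ⟩
  ∑ℚ (λ j → ∑ℚ (λ k → c k Q.* (if i≤ j then v k j else 0ℚ)))
    ≡⟨ ∑ℚ-comm (λ j k → c k Q.* (if i≤ j then v k j else 0ℚ)) ⟩
  ∑ℚ (λ k → ∑ℚ (λ j → c k Q.* (if i≤ j then v k j else 0ℚ)))
    ≡⟨ ∑ℚ-cong (λ k → *-distribˡ-sum (c k) (λ j → if i≤ j then v k j else 0ℚ)) ⟨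
  ∑ℚ (λ k → c k Q.* ∑ℚ (λ j → if i≤ j then v k j else 0ℚ))
    ≡⟨ ∑ℚ-cong (λ k → cong (c k Q.*_) (tailSum≡∑ℚ (v k) i)) ⟨
  ∑ℚ (λ k → c k Q.* tailSum (v k) i) ∎
  where
  open ≡-Reasoning
  i≤_ : Fin _ → Bool
  i≤ j = toℕ i ≤ᵇ toℕ j
  pointwise : ∀ c′ j → (if c′ then x j else 0ℚ) ≡ ∑ℚ (λ k → c k Q.* (if c′ then v k j else 0ℚ))
  pointwise true  j = x≡ j
  pointwise false j = sym (trans (∑ℚ-cong (λ k → ℚP.*-zeroʳ (c k))) (ℚΣ.sum-replicate-zero m))

-- The two inclusions

feasiblePolytope⊆hPolytope : ∀ {n} {S T : Subset n} {x : Fin n → ℚ} →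
                             InFeasiblePolytope S T x → InHPolytope S T x
feasiblePolytope⊆hPolytope {S = S} {T} {x} (m , c , R , feasible , c≥0 , Σc≡1 , x≡Σ) i =
    subst (ℕtoℚ (cardGe S i) Q.≤_) (sym tail≡)
      (convex-lower c≥0 ∑c≡1 (λ k → ℕtoℚ-mono-≤ (≤G⇒cardGe≤ (proj₁ (feasible k)) i)))
  , subst (Q._≤ ℕtoℚ (cardGe T i)) (sym tail≡)
      (convex-upper c≥0 ∑c≡1 (λ k → ℕtoℚ-mono-≤ (≤G⇒cardGe≤ (proj₂ (feasible k)) i)))
  , subst (0ℚ Q.≤_) (sym (x≡∑ i)) (convex-lower c≥0 ∑c≡1 (λ k → proj₁ (indicator-bounds (R k) i)))
  , subst (Q._≤ 1ℚ) (sym (x≡∑ i)) (convex-upper c≥0 ∑c≡1 (λ k → proj₂ (indicator-bounds (R k) i)))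
  where
  ∑c≡1 : ∑ℚ c ≡ 1ℚ
  ∑c≡1 = trans (sym (Σℚ≡∑ℚ c)) Σc≡1

  x≡∑ : ∀ j → x j ≡ ∑ℚ (λ k → c k Q.* indicator (R k) j)
  x≡∑ j = trans (x≡Σ j) (Σℚ≡∑ℚ (λ k → c k Q.* indicator (R k) j))

  tail≡ : tailSum x i ≡ ∑ℚ (λ k → c k Q.* ℕtoℚ (cardGe (R k) i))
  tail≡ = trans (tailSum-combination c (indicator ∘ R) x≡∑ i)
                (∑ℚ-cong (λ k → cong (c k Q.*_) (tailSum-indicator (R k) i)))

staircase-decomposition : ∀ {n} {S T : Subset n} {x : Fin n → ℚ} → InHPolytope S T x →
  ∀ d (b : Fin n → ℕ) → (∀ j → x j Q.* ℕtoℚ (suc d) ≡ ℕtoℚ (b j)) → InFeasiblePolytope S T x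
staircase-decomposition {n} {S} {T} {x} H d b scaled =
  D , (λ _ → 1/suc d) , R , (λ k → staircase-feasible D b b≤D lower upper (toℕ<n k)) ,
  (λ _ → 1/suc-nonNeg d) , weights-sum , x≡Σ
  where
  D = suc d

  R : Fin D → Subset n
  R k = staircase D b (toℕ k)

  instance
    D-nonNeg : Q.NonNegative (ℕtoℚ D)
    D-nonNeg = Q.nonNegative (ℕtoℚ-mono-≤ {0} {D} z≤n)

  scale : ∀ {p q} → p Q.≤ q → p Q.* ℕtoℚ D Q.≤ q Q.* ℕtoℚ D
  scale = ℚP.*-monoʳ-≤-nonNeg (ℕtoℚ D)

  b≤D : ∀ j → b j ≤ D
  b≤D j = ℕtoℚ-cancel-≤ (begin
    ℕtoℚ (b j)          ≡⟨ scaled j ⟨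
    x j Q.* ℕtoℚ D      ≤⟨ scale (proj₂ (proj₂ (proj₂ (H j)))) ⟩
    1ℚ Q.* ℕtoℚ D       ≡⟨ ℚP.*-identityˡ (ℕtoℚ D) ⟩
    ℕtoℚ D              ∎)
    where open ℚP.≤-Reasoning

  tail-scaled : ∀ i → tailSum x i Q.* ℕtoℚ D ≡ ℕtoℚ (tailSumℕ b i)
  tail-scaled i = trans (tailSum-*ʳ x (ℕtoℚ D) i) (tailSum-ℕtoℚ scaled i)

  lower : ∀ i → cardGe S i * D ≤ tailSumℕ b i
  lower i = ℕtoℚ-cancel-≤ (begin
    ℕtoℚ (cardGe S i * D)            ≡⟨ ℕtoℚ-* (cardGe S i) D ⟩
    ℕtoℚ (cardGe S i) Q.* ℕtoℚ D     ≤⟨ scale (proj₁ (H i)) ⟩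
    tailSum x i Q.* ℕtoℚ D           ≡⟨ tail-scaled i ⟩
    ℕtoℚ (tailSumℕ b i)              ∎)
    where open ℚP.≤-Reasoning

  upper : ∀ i → tailSumℕ b i ≤ cardGe T i * D
  upper i = ℕtoℚ-cancel-≤ (begin
    ℕtoℚ (tailSumℕ b i)              ≡⟨ tail-scaled i ⟨
    tailSum x i Q.* ℕtoℚ D           ≤⟨ scale (proj₁ (proj₂ (H i))) ⟩
    ℕtoℚ (cardGe T i) Q.* ℕtoℚ D     ≡⟨ ℕtoℚ-* (cardGe T i) D ⟨
    ℕtoℚ (cardGe T i * D)            ∎)
    where open ℚP.≤-Reasoning

  weights-sum : Σℚ {D} (λ _ → 1/suc d) ≡ 1ℚ
  weights-sum = begin
    Σℚ {D} (λ _ → 1/suc d)     ≡⟨ Σℚ≡∑ℚ {D} (λ _ → 1/suc d) ⟩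
    ∑ℚ {D} (λ _ → 1/suc d)     ≡⟨ ∑ℚ-const D (1/suc d) ⟩
    ℕtoℚ D Q.* 1/suc d         ≡⟨ ℚP.*-comm (ℕtoℚ D) (1/suc d) ⟩
    1/suc d Q.* ℕtoℚ D         ≡⟨ 1/suc-inverseˡ d ⟩
    1ℚ                         ∎
    where open ≡-Reasoning

  x≡Σ : ∀ j → x j ≡ Σℚ (λ k → 1/suc d Q.* indicator (R k) j)
  x≡Σ j = sym (begin
    Σℚ (λ k → 1/suc d Q.* indicator (R k) j)
      ≡⟨ Σℚ≡∑ℚ (λ k → 1/suc d Q.* indicator (R k) j) ⟩
    ∑ℚ (λ k → 1/suc d Q.* indicator (R k) j)
      ≡⟨ *-distribˡ-sum (1/suc d) (λ k → indicator (R k) j) ⟨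
    1/suc d Q.* ∑ℚ (λ k → indicator (R k) j)
      ≡⟨ cong (1/suc d Q.*_) (∑ℚ-cong (λ k → indicator≡bit (R k) j)) ⟩
    1/suc d Q.* ∑ℚ (λ k → ℕtoℚ (bit (lookup (R k) j)))
      ≡⟨ cong (1/suc d Q.*_) (ℕtoℚ-∑ (λ k → bit (lookup (R k) j))) ⟨
    1/suc d Q.* ℕtoℚ (∑ℕ (λ k → bit (lookup (R k) j)))
      ≡⟨ cong (λ m → 1/suc d Q.* ℕtoℚ m) (staircase-column D b b≤D j) ⟩
    1/suc d Q.* ℕtoℚ (b j)
      ≡⟨ cong (1/suc d Q.*_) (scaled j) ⟨
    1/suc d Q.* (x j Q.* ℕtoℚ D)
      ≡⟨ cong (1/suc d Q.*_) (ℚP.*-comm (x j) (ℕtoℚ D)) ⟩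
    1/suc d Q.* (ℕtoℚ D Q.* x j)
      ≡⟨ ℚP.*-assoc (1/suc d) (ℕtoℚ D) (x j) ⟨
    (1/suc d Q.* ℕtoℚ D) Q.* x j
      ≡⟨ cong (Q._* x j) (1/suc-inverseˡ d) ⟩
    1ℚ Q.* x j
      ≡⟨ ℚP.*-identityˡ (x j) ⟩
    x j ∎)
    where open ≡-Reasoning

hPolytope⊆feasiblePolytope : ∀ {n} {S T : Subset n} {x : Fin n → ℚ} →
                             InHPolytope S T x → InFeasiblePolytope S T x
hPolytope⊆feasiblePolytope {x = x} H with common-denominator x (λ j → proj₁ (proj₂ (proj₂ (H j))))
... | d , b , scaled = staircase-decomposition H d b scaled

theorem4p2 : (n : ℕ) → 1 ≤ n → (S T : Subset n) → S ≤G T →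
    (x : Fin n → ℚ) → InFeasiblePolytope S T x ⇔ InHPolytope S T x
theorem4p2 _ _ _ _ _ _ = mk⇔ feasiblePolytope⊆hPolytope hPolytope⊆feasiblePolytope
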